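{- For a Boolean function $f:\{0,1\}^n\to\{0,1\}$ and $z\in\{0,1\}$, $$\mathsf{MCC}^{z}(f)\leq \mathsf{mbs}^{z}(f)\,\mathsf{ms}^{1-z}(\tilde{f}),$$ where $\tilde f(x):=f(1-x_1,1-x_2,\dots,1-x_n)$.
   Context: For $x\in\{0,1\}^n$ let $\mathrm{supp}(x)=\{i:x_i=1\}$, $|x|=|\mathrm{supp}(x)|$, and let $f_x$ be the restriction of $f$ to $\{y:y_i=1\ \forall i\in\mathrm{supp}(x)\}$, viewed as a function of the remaining $n-|x|$ coordinates. For a Boolean function $h$ and input $w$: $\mathsf{s}(h,w)$ is the number of coordinates $i$ with $h(w^{\oplus i})\ne h(w)$; $\mathsf{bs}(h,w)$ is the maximum number of pairwise disjoint sets $B$ with $h(w^B)\ne h(w)$ ($w^B$ = $w$ with bits in $B$ flipped); $\mathsf{C}(h,w)$ is the minimum size of a set $C$ of coordinates such that every $y$ agreeing with $w$ on $C$ has $h(y)=h(w)$. Define $\mathsf{ms}(f,x)=\mathsf{s}(f_x,0^{n-|x|})$, $\mathsf{mbs}(f,x)=\mathsf{bs}(f_x,0^{n-|x|})$, $\mathsf{MCC}(f,x)=\mathsf{C}(f_x,0^{n-|x|})$, and for a measure $M$ and $b\in\{0,1\}$, $M^b(f)=\max_{x\in f^{ -1}(b)}M(f,x)$. -}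

module Defs where

open import Data.Bool using (Bool; true; false; not; _xor_; _∧_; if_then_else_)
open import Data.Nat using (ℕ; zero; suc; _+_; _≤_)
open import Data.Fin using (Fin)
open import Data.Vec using (Vec; []; _∷_; lookup; zipWith; replicate; map; _[_]%=_)
open import Data.List using (List; allFin) renaming (map to lmap)
open import Data.Nat.ListAction using (sum)
open import Data.Product using (Σ; _×_; ∃; ∃-syntax)
open import Data.Sum using (_⊎_)
open import Relation.Binary.PropositionalEquality using (_≡_; _≢_)
open import Relation.Nullary using (¬_)

-- Inputs in {0,1}^m are Vec Bool m (true = 1); subsets of coordinates are Vec Bool m too.
Input : ℕ → Set
Input m = Vec Bool m

BoolFun : ℕ → Set
BoolFun m = Input m → Bool

weight : ∀ {m} → Vec Bool m → ℕ
weight [] = 0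
weight (true ∷ v) = suc (weight v)
weight (false ∷ v) = weight v

zeros : ∀ {n} → Vec Bool n → ℕ
zeros [] = 0
zeros (true ∷ v) = zeros v
zeros (false ∷ v) = suc (zeros v)

fill : ∀ {n} (x : Vec Bool n) → Vec Bool (zeros x) → Vec Bool n
fill [] z = []
fill (true ∷ x) z = true ∷ fill x z
fill (false ∷ x) (b ∷ z) = b ∷ fill x z

-- f_x : restriction of f to {y : y_i = 1 ∀ i ∈ supp x}, as a function of the remaining coordinates
restrict : ∀ {n} → BoolFun n → (x : Input n) → BoolFun (zeros x)
restrict f x z = f (fill x z)

flipSet : ∀ {m} → Input m → Vec Bool m → Input m
flipSet w B = zipWith _xor_ w B

flipAt : ∀ {m} → Fin m → Input m → Input m
flipAt i w = w [ i ]%= not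

sens : ∀ {m} → BoolFun m → Input m → ℕ
sens {m} h w = sum (lmap (λ i → if h (flipAt i w) xor h w then 1 else 0) (allFin m))

-- k is the maximum of P (convention: 0 if P is empty)
IsMax : (ℕ → Set) → ℕ → Set
IsMax P k = (∀ j → P j → j ≤ k) × (P k ⊎ k ≡ 0)

IsMin : (ℕ → Set) → ℕ → Set
IsMin P k = P k × (∀ j → P j → k ≤ j)

PairwiseDisjoint : ∀ {m k} → (Fin k → Vec Bool m) → Set
PairwiseDisjoint {m} {k} B = ∀ (a b : Fin k) → a ≢ b → ∀ (t : Fin m) → lookup (B a) t ∧ lookup (B b) t ≡ false

HasDisjointBlocks : ∀ {m} → BoolFun m → Input m → ℕ → Set
HasDisjointBlocks {m} h w k =
  Σ (Fin k → Vec Bool m) λ B → PairwiseDisjoint B × (∀ a → h (flipSet w (B a)) ≢ h w)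

BlockSens : ∀ {m} → BoolFun m → Input m → ℕ → Set
BlockSens h w = IsMax (HasDisjointBlocks h w)

IsCertificate : ∀ {m} → BoolFun m → Input m → Vec Bool m → Set
IsCertificate {m} h w C =
  ∀ (y : Input m) → (∀ (i : Fin m) → lookup C i ≡ true → lookup y i ≡ lookup w i) → h y ≡ h w

HasCertificateOfSize : ∀ {m} → BoolFun m → Input m → ℕ → Set
HasCertificateOfSize {m} h w k = Σ (Vec Bool m) λ C → weight C ≡ k × IsCertificate h w C

CertComplexity : ∀ {m} → BoolFun m → Input m → ℕ → Set
CertComplexity h w = IsMin (HasCertificateOfSize h w)

ms : ∀ {n} → BoolFun n → Input n → ℕ
ms f x = sens (restrict f x) (replicate _ false)

Mbs : ∀ {n} → BoolFun n → Input n → ℕ → Set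
Mbs f x = BlockSens (restrict f x) (replicate _ false)

MCC : ∀ {n} → BoolFun n → Input n → ℕ → Set
MCC f x = CertComplexity (restrict f x) (replicate _ false)

MaxOver : ∀ {n} → (BoolFun n → Input n → ℕ → Set) → Bool → BoolFun n → ℕ → Set
MaxOver M b f = IsMax (λ j → ∃[ x ] (f x ≡ b × M f x j))

Ms : ∀ {n} → BoolFun n → Input n → ℕ → Set
Ms f x k = ms f x ≡ k

negInput : ∀ {n} → BoolFun n → BoolFun n
negInput f x = f (map not x)

-- Fix x ∈ f⁻¹(z) attaining MCC^z(f) and let h = f_x. Greedily choose a sensitive block
-- of h at 0 that avoids the blocks chosen so far and shrink it to a minimal one; once no
-- sensitive block avoids their union, that union certifies h at 0. The chosen blocks are
-- disjoint and sensitive, so there are at most bs(h,0) ≤ mbs^z(f) of them, and each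
-- minimal block B has |B| ≤ ms^{1-z}(f̃): at x′ = 1 − (x ∨ B) we have f̃(x′) = f(x ∨ B) = 1 − z,
-- and by minimality f̃_{x′} is sensitive at 0 to every coordinate of B.
module Submission where

open import Defs
open import Data.Bool using (Bool; true; false; not; _∧_; _xor_; if_then_else_)
open import Data.Bool.Properties using (_≟_; ∧-comm; ¬-not; not-involutive)
open import Data.Nat using (ℕ; zero; suc; _+_; _*_; _≤_; _<_; z≤n; s≤s; s≤s⁻¹; _≤?_)
open import Data.Nat.Properties
  using (≤-refl; ≤-trans; ≤-reflexive; n≤1+n; m≤n+m; +-suc; +-mono-≤; +-monoʳ-≤; *-monoˡ-≤;
         ≤∧≢⇒<; ≰⇒>; module ≤-Reasoning)
open import Data.Nat.Induction using (<-wellFounded)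
open import Data.Nat.ListAction using (sum)
open import Data.Fin using (Fin; zero; suc)
open import Data.Fin.Properties using (any?; pigeonhole; <⇒≢)
open import Data.Fin.Subset using (Subset; _∈_; _∉_; _⊆_; _─_; _∪_; ∁; ∣_∣; ⊤; Nonempty)
  renaming (⊥ to ∅)
open import Data.Fin.Subset.Properties
  using (_∈?_; _⊆?_; ⊆-refl; ⊆-trans; ⊆⊤; p─q⊆p; x∈p∧x∉q⇒x∈p─q; p⊆p∪q; q⊆p∪q; x∈p∩q⁺;
         p∩q≢∅⇒∣p─q∣<∣p∣; ∣⊥∣≡0; nonempty?; Empty-unique; anySubset?)
open import Data.List using (tabulate)
open import Data.List.Properties using (map-tabulate)
open import Data.Product using (∃; ∃₂; _×_; _,_; proj₁; proj₂)
open import Data.Sum using (inj₁; inj₂)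
open import Data.Vec using ([]; _∷_; here; there; lookup)
open import Data.Vec.Properties
  using (lookup⇒[]=; []=⇒lookup; lookup-replicate; map-∘; map-cong; map-id; zipWith-replicate₁)
import Data.Vec.Functional as Vector
open import Effect.Monad using (RawMonad)
open import Function using (id; _∘_)
open import Induction.WellFounded using (Acc; acc)
open import Level using (0ℓ)
open import Relation.Binary.PropositionalEquality
  using (_≡_; _≢_; refl; sym; trans; cong; cong₂; subst; module ≡-Reasoning)
open import Relation.Nullary using (¬?; yes; no; contradiction)
open import Relation.Nullary.Decidable using (_×-dec_; decidable-stable; ¬¬-excluded-middle)
open import Relation.Nullary.Negation using (DoubleNegation; ¬¬-Monad)

private
  variable
    m n : ℕ

weight≡∣∣ : (p : Subset m) → weight p ≡ ∣ p ∣
weight≡∣∣ [] = refl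
weight≡∣∣ (true ∷ p) = cong suc (weight≡∣∣ p)
weight≡∣∣ (false ∷ p) = weight≡∣∣ p

∣p∪q∣≤∣p∣+∣q∣ : (p q : Subset m) → ∣ p ∪ q ∣ ≤ ∣ p ∣ + ∣ q ∣
∣p∪q∣≤∣p∣+∣q∣ [] [] = z≤n
∣p∪q∣≤∣p∣+∣q∣ (true ∷ p) (true ∷ q) =
  s≤s (≤-trans (∣p∪q∣≤∣p∣+∣q∣ p q) (+-monoʳ-≤ ∣ p ∣ (n≤1+n ∣ q ∣)))
∣p∪q∣≤∣p∣+∣q∣ (true ∷ p) (false ∷ q) = s≤s (∣p∪q∣≤∣p∣+∣q∣ p q)
∣p∪q∣≤∣p∣+∣q∣ (false ∷ p) (true ∷ q) =
  subst (suc ∣ p ∪ q ∣ ≤_) (sym (+-suc ∣ p ∣ ∣ q ∣)) (s≤s (∣p∪q∣≤∣p∣+∣q∣ p q))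
∣p∪q∣≤∣p∣+∣q∣ (false ∷ p) (false ∷ q) = ∣p∪q∣≤∣p∣+∣q∣ p q

x∈p─q⇒x∉q : ∀ {x} (p q : Subset m) → x ∈ p ─ q → x ∉ q
x∈p─q⇒x∉q (_ ∷ p) (_ ∷ q) (there x∈p─q) (there x∈q) = x∈p─q⇒x∉q p q x∈p─q x∈q

flipAt-⊆ : ∀ {j} {p : Subset m} → j ∈ p → flipAt j p ⊆ p
flipAt-⊆ here (there i∈p) = there i∈p
flipAt-⊆ (there j∈p) here = here
flipAt-⊆ (there j∈p) (there i∈p) = there (flipAt-⊆ j∈p i∈p)

∣flipAt∣<∣p∣ : ∀ {j} {p : Subset m} → j ∈ p → ∣ flipAt j p ∣ < ∣ p ∣
∣flipAt∣<∣p∣ here = ≤-refl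
∣flipAt∣<∣p∣ {p = true ∷ _} (there j∈p) = s≤s (∣flipAt∣<∣p∣ j∈p)
∣flipAt∣<∣p∣ {p = false ∷ _} (there j∈p) = ∣flipAt∣<∣p∣ j∈p

lookup-∧≡false : {p q : Subset m} → (∀ {t} → t ∈ p → t ∉ q) →
                 ∀ t → lookup p t ∧ lookup q t ≡ false
lookup-∧≡false {p = p} {q} disjoint t with lookup p t in p[t] | lookup q t in q[t]
... | false | _ = refl
... | true | false = refl
... | true | true = contradiction (lookup⇒[]= t q q[t]) (disjoint (lookup⇒[]= t p p[t]))

∧≡false⇒∉ : ∀ {p q : Subset m} {t} → lookup p t ∧ lookup q t ≡ false → t ∈ p → t ∉ q
∧≡false⇒∉ p∧q≡false t∈p t∈q
  with trans (sym (cong₂ _∧_ ([]=⇒lookup t∈p) ([]=⇒lookup t∈q))) p∧q≡false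
... | ()

flipSet-∅ : (B : Subset m) → flipSet ∅ B ≡ B
flipSet-∅ B = trans (zipWith-replicate₁ _xor_ false B) (map-id B)

∁-involutive : (v : Subset m) → ∁ (∁ v) ≡ v
∁-involutive v = trans (sym (map-∘ not not v)) (trans (map-cong not-involutive v) (map-id v))

-- A block B is identified with the input 0^m flipped on B, which is B itself.
Sensitive : BoolFun m → Subset m → Set
Sensitive h B = h B ≢ h ∅

Minimal : BoolFun m → Subset m → Set
Minimal h B = Sensitive h B × (∀ {j} → j ∈ B → h (flipAt j B) ≡ h ∅)

sensitive⇒nonempty : (h : BoolFun m) {B : Subset m} → Sensitive h B → Nonempty B
sensitive⇒nonempty h {B} sensitive with nonempty? B
... | yes nonempty = nonempty
... | no empty = contradiction (cong h (Empty-unique empty)) sensitive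

minimal⊆ : (h : BoolFun m) (B : Subset m) → Sensitive h B → ∃ λ B′ → B′ ⊆ B × Minimal h B′
minimal⊆ h B = shrink B (<-wellFounded ∣ B ∣)
  where
  shrink : ∀ B → Acc _<_ ∣ B ∣ → Sensitive h B → ∃ λ B′ → B′ ⊆ B × Minimal h B′
  shrink B (acc smaller) sensitive with any? (λ j → j ∈? B ×-dec ¬? (h (flipAt j B) ≟ h ∅))
  ... | yes (j , j∈B , sensitive′)
      with shrink (flipAt j B) (smaller (∣flipAt∣<∣p∣ j∈B)) sensitive′
  ...   | B′ , B′⊆ , minimal = B′ , ⊆-trans B′⊆ (flipAt-⊆ j∈B) , minimal
  shrink B (acc smaller) sensitive | no none =
    B , ⊆-refl , sensitive , λ j∈B → decidable-stable (_ ≟ _) (λ ne → none (_ , j∈B , ne))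

disjointBlocks≤ : (h : BoolFun m) (k : ℕ) → HasDisjointBlocks h ∅ k → k ≤ m
disjointBlocks≤ {m} h k (B , disjoint , sensitive) with k ≤? m
... | yes k≤m = k≤m
... | no k≰m = contradiction (pigeonhole (≰⇒> k≰m) (proj₁ ∘ element)) λ
  { (a , a′ , a<a′ , same) → ∧≡false⇒∉ (disjoint a a′ (<⇒≢ a<a′) _) (proj₂ (element a))
                                        (subst (_∈ B a′) (sym same) (proj₂ (element a′))) }
  where
  element : ∀ a → Nonempty (B a)
  element a = sensitive⇒nonempty h (subst (λ v → h v ≢ h ∅) (flipSet-∅ (B a)) (sensitive a))

module Greedy {m} (h : BoolFun m) {c : ℕ} (minimal≤c : ∀ {B} → Minimal h B → ∣ B ∣ ≤ c) where

  record Decomposition (U : Subset m) : Set where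
    field
      size : ℕ
      block : Fin size → Subset m
      disjoint : PairwiseDisjoint block
      block⊆U : ∀ a → block a ⊆ U
      sensitive : ∀ a → Sensitive h (block a)
      cert : Subset m
      ∣cert∣≤ : ∣ cert ∣ ≤ size * c
      certifies : ∀ {y} → y ⊆ U → (∀ {i} → i ∈ y → i ∉ cert) → h y ≡ h ∅

  trivial : ∀ {U} → (∀ {y} → y ⊆ U → h y ≡ h ∅) → Decomposition U
  trivial constant = record
    { size = 0 ; block = λ () ; disjoint = λ () ; block⊆U = λ () ; sensitive = λ ()
    ; cert = ∅ ; ∣cert∣≤ = ≤-reflexive (∣⊥∣≡0 m) ; certifies = λ y⊆U _ → constant y⊆U }

  extend : ∀ {U B} → B ⊆ U → Minimal h B → Decomposition (U ─ B) → Decomposition U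
  extend {U} {B} B⊆U minimal D = record
    { size = suc size
    ; block = B Vector.∷ block
    ; disjoint = disjoint′
    ; block⊆U = λ { zero → B⊆U ; (suc a) → p─q⊆p U B ∘ block⊆U a }
    ; sensitive = λ { zero → proj₁ minimal ; (suc a) → sensitive a }
    ; cert = B ∪ cert
    ; ∣cert∣≤ = ≤-trans (∣p∪q∣≤∣p∣+∣q∣ B cert) (+-mono-≤ (minimal≤c minimal) ∣cert∣≤)
    ; certifies = λ y⊆U avoids →
        certifies (λ i∈y → x∈p∧x∉q⇒x∈p─q (y⊆U i∈y) (avoids i∈y ∘ p⊆p∪q cert))
                  (λ i∈y → avoids i∈y ∘ q⊆p∪q B cert)
    }
    where
    open Decomposition D
    B-disjoint : ∀ a t → lookup B t ∧ lookup (block a) t ≡ false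
    B-disjoint a = lookup-∧≡false (λ t∈B t∈a → x∈p─q⇒x∉q U B (block⊆U a t∈a) t∈B)
    disjoint′ : PairwiseDisjoint (B Vector.∷ block)
    disjoint′ zero zero ne = contradiction refl ne
    disjoint′ zero (suc a) _ t = B-disjoint a t
    disjoint′ (suc a) zero _ t = trans (∧-comm (lookup (block a) t) _) (B-disjoint a t)
    disjoint′ (suc a) (suc a′) ne = disjoint a a′ (ne ∘ cong suc)

  decompose : ∀ U → Acc _<_ ∣ U ∣ → Decomposition U
  decompose U (acc smaller) with anySubset? (λ y → y ⊆? U ×-dec ¬? (h y ≟ h ∅))
  ... | no none = trivial λ y⊆U → decidable-stable (_ ≟ _) (λ ne → none (_ , y⊆U , ne))
  ... | yes (y , y⊆U , sensitive) with minimal⊆ h y sensitive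
  ...   | B , B⊆y , minimal with sensitive⇒nonempty h (proj₁ minimal)
  ...     | i , i∈B = extend B⊆U minimal (decompose (U ─ B) (smaller U─B-smaller))
    where
    B⊆U : B ⊆ U
    B⊆U = ⊆-trans B⊆y y⊆U
    U─B-smaller : ∣ U ─ B ∣ < ∣ U ∣
    U─B-smaller = p∩q≢∅⇒∣p─q∣<∣p∣ U B (i , x∈p∩q⁺ (B⊆U i∈B , i∈B))

  certificate≤blocks*c :
    ∃₂ λ k C → HasDisjointBlocks h ∅ k × IsCertificate h ∅ C × weight C ≤ k * c
  certificate≤blocks*c =
    size , cert , (block , disjoint , sensitive′) , certificate ,
    subst (_≤ size * c) (sym (weight≡∣∣ cert)) ∣cert∣≤
    where
    open Decomposition (decompose ⊤ (<-wellFounded _))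
    sensitive′ : ∀ a → h (flipSet ∅ (block a)) ≢ h ∅
    sensitive′ a = subst (λ v → h v ≢ h ∅) (sym (flipSet-∅ (block a))) (sensitive a)
    certificate : IsCertificate h ∅ cert
    certificate y agrees = certifies ⊆⊤ λ {i} i∈y i∈cert → contradiction
      (trans (sym ([]=⇒lookup i∈y)) (trans (agrees i ([]=⇒lookup i∈cert)) (lookup-replicate i false)))
      λ ()

1≤[≢] : ∀ {a b} → a ≢ b → 1 ≤ (if a xor b then 1 else 0)
1≤[≢] {true} {true} ne = contradiction refl ne
1≤[≢] {true} {false} _ = s≤s z≤n
1≤[≢] {false} {true} _ = s≤s z≤n
1≤[≢] {false} {false} ne = contradiction refl ne

∣p∣≤sum : (p : Subset m) (g : Fin m → ℕ) → (∀ {i} → i ∈ p → 1 ≤ g i) → ∣ p ∣ ≤ sum (tabulate g)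
∣p∣≤sum [] g _ = z≤n
∣p∣≤sum (true ∷ p) g positive =
  +-mono-≤ (positive here) (∣p∣≤sum p (g ∘ suc) (positive ∘ there))
∣p∣≤sum (false ∷ p) g positive =
  ≤-trans (∣p∣≤sum p (g ∘ suc) (positive ∘ there)) (m≤n+m _ (g zero))

sensitive-coordinates≤sens : (h : BoolFun m) (w : Input m) (S : Subset m) →
  (∀ {i} → i ∈ S → h (flipAt i w) ≢ h w) → ∣ S ∣ ≤ sens h w
sensitive-coordinates≤sens {m} h w S sensitive =
  subst (∣ S ∣ ≤_) (cong sum (sym (map-tabulate id indicator)))
        (∣p∣≤sum S indicator (1≤[≢] ∘ sensitive))
  where
  indicator : Fin m → ℕ
  indicator i = if h (flipAt i w) xor h w then 1 else 0

fill-∅ : (x : Input n) → fill x ∅ ≡ x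
fill-∅ [] = refl
fill-∅ (true ∷ x) = cong (true ∷_) (fill-∅ x)
fill-∅ (false ∷ x) = cong (false ∷_) (fill-∅ x)

-- The coordinates of B, as a subset of the free coordinates supp(x) ∪ B of ∁ (fill x B).
embed : (x : Input n) (B : Subset (zeros x)) → Subset (zeros (∁ (fill x B)))
embed [] [] = []
embed (true ∷ x) B = false ∷ embed x B
embed (false ∷ x) (true ∷ B) = true ∷ embed x B
embed (false ∷ x) (false ∷ B) = embed x B

∣embed∣ : (x : Input n) (B : Subset (zeros x)) → ∣ embed x B ∣ ≡ ∣ B ∣
∣embed∣ [] [] = refl
∣embed∣ (true ∷ x) B = ∣embed∣ x B
∣embed∣ (false ∷ x) (true ∷ B) = cong suc (∣embed∣ x B)
∣embed∣ (false ∷ x) (false ∷ B) = ∣embed∣ x B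

∁-fill-∁-fill-∅ : (x : Input n) (B : Subset (zeros x)) → ∁ (fill (∁ (fill x B)) ∅) ≡ fill x B
∁-fill-∁-fill-∅ x B = trans (cong ∁ (fill-∅ (∁ (fill x B)))) (∁-involutive (fill x B))

∁-fill-∁-fill-flipAt : (x : Input n) (B : Subset (zeros x)) {i : Fin (zeros (∁ (fill x B)))} →
  i ∈ embed x B → ∃ λ j → j ∈ B × ∁ (fill (∁ (fill x B)) (flipAt i ∅)) ≡ fill x (flipAt j B)
∁-fill-∁-fill-flipAt (true ∷ x) B (there i∈) with ∁-fill-∁-fill-flipAt x B i∈
... | j , j∈B , eq = j , j∈B , cong (true ∷_) eq
∁-fill-∁-fill-flipAt (false ∷ x) (true ∷ B) here =
  zero , here , cong (false ∷_) (∁-fill-∁-fill-∅ x B)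
∁-fill-∁-fill-flipAt (false ∷ x) (true ∷ B) (there i∈) with ∁-fill-∁-fill-flipAt x B i∈
... | j , j∈B , eq = suc j , there j∈B , cong (true ∷_) eq
∁-fill-∁-fill-flipAt (false ∷ x) (false ∷ B) i∈ with ∁-fill-∁-fill-flipAt x B i∈
... | j , j∈B , eq = suc j , there j∈B , cong (false ∷_) eq

minimal-block≤ms : (f : BoolFun n) {z : Bool} {c : ℕ} → MaxOver Ms (not z) (negInput f) c →
  (x : Input n) {B : Subset (zeros x)} → f x ≡ z → Minimal (restrict f x) B → ∣ B ∣ ≤ c
minimal-block≤ms f {z} (≤c , _) x {B} fx≡z (sensitive , minimal) =
  ≤-trans ∣B∣≤ms (≤c _ (x′ , f̃x′≡¬z , refl))
  where
  x′ = ∁ (fill x B)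
  f̃x′≡¬z : negInput f x′ ≡ not z
  f̃x′≡¬z = trans (cong f (∁-involutive (fill x B)))
                 (¬-not λ fB≡z → sensitive (trans fB≡z (sym (trans (cong f (fill-∅ x)) fx≡z))))
  ∣B∣≤ms : ∣ B ∣ ≤ ms (negInput f) x′
  ∣B∣≤ms = subst (_≤ ms (negInput f) x′) (∣embed∣ x B)
    (sensitive-coordinates≤sens (restrict (negInput f) x′) ∅ (embed x B) flip-sensitive)
    where
    flip-sensitive : ∀ {i} → i ∈ embed x B →
      restrict (negInput f) x′ (flipAt i ∅) ≢ restrict (negInput f) x′ ∅
    flip-sensitive {i} i∈ eq with ∁-fill-∁-fill-flipAt x B i∈
    ... | j , j∈B , flipped = sensitive (begin
      f (fill x B)                  ≡⟨ cong f (∁-fill-∁-fill-∅ x B) ⟨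
      f (∁ (fill x′ ∅))             ≡⟨ eq ⟨
      f (∁ (fill x′ (flipAt i ∅)))  ≡⟨ cong f flipped ⟩
      f (fill x (flipAt j B))       ≡⟨ minimal j∈B ⟩
      f (fill x ∅)                  ∎)
      where open ≡-Reasoning

-- bs(f_x, 0) exists only classically (HasDisjointBlocks is not decidable); this is harmless
-- because the goal a ≤ b * c is decidable.
open RawMonad (¬¬-Monad {a = 0ℓ}) using (pure; _>>=_)

bounded-max : (P : ℕ → Set) (m : ℕ) → (∀ j → P j → j ≤ m) → DoubleNegation (∃ (IsMax P))
bounded-max P zero bound = pure (0 , bound , inj₂ refl)
bounded-max P (suc m) bound = ¬¬-excluded-middle >>= λ where
  (yes Pm) → pure (suc m , bound , inj₁ Pm)
  (no ¬Pm) → bounded-max P m λ j Pj → s≤s⁻¹ (≤∧≢⇒< (bound j Pj) λ { refl → ¬Pm Pj })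

theorem4 : ∀ (n : ℕ) (f : BoolFun n) (z : Bool) (a b c : ℕ) →
    MaxOver MCC z f a → MaxOver Mbs z f b → MaxOver Ms (not z) (negInput f) c →
    a ≤ b * c
theorem4 n f z a b c (_ , inj₂ refl) _ _ = z≤n
theorem4 n f z a b c (_ , inj₁ (x , fx≡z , _ , a≤certificates)) (≤b , _) ms≤c
  with Greedy.certificate≤blocks*c (restrict f x) (minimal-block≤ms f ms≤c x fx≡z)
... | k , C , blocks , certificate , weight≤ = decidable-stable (a ≤? b * c) do
  j , bs=j ← bounded-max (HasDisjointBlocks h ∅) (zeros x) (disjointBlocks≤ h)
  pure (begin
    a        ≤⟨ a≤certificates (weight C) (C , refl , certificate) ⟩
    weight C ≤⟨ weight≤ ⟩
    k * c    ≤⟨ *-monoˡ-≤ c (proj₁ bs=j k blocks) ⟩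
    j * c    ≤⟨ *-monoˡ-≤ c (≤b j (x , fx≡z , bs=j)) ⟩
    b * c    ∎)
  where
  h = restrict f x
  open ≤-Reasoning
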